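{- For any $w_1,w_2\in\mathfrak{h}_t$, we have $$S_t\big(w_1\overset{t}{\sqcup\!\sqcup} w_2\big)=S_t(w_1)\sqcup\!\sqcup S_t(w_2).$$
   Context: Let $A=\{x,y\}$ be an alphabet of two noncommutative letters, $A^{\ast}$ the set of words (including the empty word $1$), and $\mathfrak{h}_t=\mathbb{Q}[t]\langle A\rangle$. Let $\sigma_t$ be the algebra automorphism of $\mathfrak{h}_t$ with $\sigma_t(x)=x$, $\sigma_t(y)=tx+y$, and $S_t:\mathfrak{h}_t\to\mathfrak{h}_t$ the $\mathbb{Q}[t]$-linear map with $S_t(1)=1$, $S_t(wa)=\sigma_t(w)a$ ($w\in\mathfrak{h}_t$, $a\in A$). $\sqcup\!\sqcup$ denotes the usual shuffle product, extended $\mathbb{Q}[t]$-bilinearly: $1\sqcup\!\sqcup w=w\sqcup\!\sqcup 1=w$, $aw_1\sqcup\!\sqcup bw_2=a(w_1\sqcup\!\sqcup bw_2)+b(aw_1\sqcup\!\sqcup w_2)$. The $t$-shuffle product $\overset{t}{\sqcup\!\sqcup}$ is the $\mathbb{Q}[t]$-bilinear product on $\mathfrak{h}_t$ with $1\overset{t}{\sqcup\!\sqcup} w=w\overset{t}{\sqcup\!\sqcup} 1=w$ and $aw_1\overset{t}{\sqcup\!\sqcup} bw_2=a(w_1\overset{t}{\sqcup\!\sqcup} bw_2)+b(aw_1\overset{t}{\sqcup\!\sqcup} w_2)-\delta(w_1)\rho(a)bw_2-\delta(w_2)\rho(b)aw_1$ for $w,w_1,w_2\in A^\ast$, $a,b\in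 A$, where $\delta(w)=1$ if $w=1$ and $0$ otherwise, and $\rho(x)=0$, $\rho(y)=tx$. -}

module Defs where

open import Data.Nat using (ℕ; zero; suc)
import Data.Nat as ℕ
open import Data.Rational using (ℚ; 0ℚ; 1ℚ; -_)
import Data.Rational as ℚ
open import Data.List using (List; []; _∷_; _++_; map; concatMap; foldr)
open import Data.Product using (_×_; _,_)
open import Relation.Binary.PropositionalEquality using (_≡_)
open import Relation.Nullary.Decidable using (does)
open import Data.Bool using (if_then_else_; _∧_)

data Letter : Set where
  x y : Letter

Word : Set
Word = List Letter

_≟L_ : Letter → Letter → Data.Bool.Bool
x ≟L x = Data.Bool.true
y ≟L y = Data.Bool.true
_ ≟L _ = Data.Bool.false

_≟W_ : Word → Word → Data.Bool.Bool
[] ≟W [] = Data.Bool.true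
(a ∷ u) ≟W (b ∷ v) = (a ≟L b) ∧ (u ≟W v)
_ ≟W _ = Data.Bool.false

-- Elements of h_t = ℚ[t]<A> are represented as finite formal sums of
-- monomials  q · t^k · w  (q ∈ ℚ, k ∈ ℕ, w ∈ A*).
Term : Set
Term = ℚ × ℕ × Word

Ht : Set
Ht = List Term

coeff : Ht → ℕ → Word → ℚ
coeff [] k u = 0ℚ
coeff ((q , j , w) ∷ p) k u =
  (if does (j ℕ.≟ k) ∧ (w ≟W u) then q else 0ℚ) ℚ.+ coeff p k u

infix 4 _≈_
_≈_ : Ht → Ht → Set
p ≈ r = ∀ k u → coeff p k u ≡ coeff r k u

one : Ht
one = (1ℚ , 0 , []) ∷ []

word : Word → Ht
word w = (1ℚ , 0 , w) ∷ []

_⊕_ : Ht → Ht → Ht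
p ⊕ r = p ++ r

negate : Ht → Ht
negate = map (λ { (q , k , w) → (- q , k , w) })

_⊖_ : Ht → Ht → Ht
p ⊖ r = p ⊕ negate r

_⊛_ : Ht → Ht → Ht
p ⊛ r = concatMap (λ { (q₁ , k₁ , w₁) →
          map (λ { (q₂ , k₂ , w₂) → (q₁ ℚ.* q₂ , k₁ ℕ.+ k₂ , w₁ ++ w₂) }) r }) p

bilin : (Word → Word → Ht) → Ht → Ht → Ht
bilin f p r = concatMap (λ { (q₁ , k₁ , w₁) → concatMap (λ { (q₂ , k₂ , w₂) →
    map (λ { (q , k , w) → (q₁ ℚ.* q₂ ℚ.* q , k₁ ℕ.+ k₂ ℕ.+ k , w) }) (f w₁ w₂) }) r }) p

lin : (Word → Ht) → Ht → Ht
lin f p = concatMap (λ { (q₁ , k₁ , w₁) →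
    map (λ { (q , k , w) → (q₁ ℚ.* q , k₁ ℕ.+ k , w) }) (f w₁) }) p

-- σ_t : algebra automorphism, σ_t(x) = x, σ_t(y) = t x + y
σL : Letter → Ht
σL x = word (x ∷ [])
σL y = (1ℚ , 1 , x ∷ []) ∷ (1ℚ , 0 , y ∷ []) ∷ []

-- S_t on words: S_t(1) = 1, S_t(w a) = σ_t(w) a
Sw : Word → Ht
Sw [] = one
Sw (a ∷ []) = word (a ∷ [])
Sw (a ∷ b ∷ w) = σL a ⊛ Sw (b ∷ w)

S : Ht → Ht
S = lin Sw

shw : Word → Word → Ht
shw [] v = word v
shw (a ∷ u) [] = word (a ∷ u)
shw (a ∷ u) (b ∷ v) =
  (word (a ∷ []) ⊛ shw u (b ∷ v)) ⊕ (word (b ∷ []) ⊛ shw (a ∷ u) v)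

_⧢_ : Ht → Ht → Ht
_⧢_ = bilin shw

δ : Word → ℚ
δ [] = 1ℚ
δ (_ ∷ _) = 0ℚ

ρ : Letter → Ht
ρ x = []
ρ y = (1ℚ , 1 , x ∷ []) ∷ []

scal : ℚ → Ht → Ht
scal c = map (λ { (q , k , w) → (c ℚ.* q , k , w) })

tshw : Word → Word → Ht
tshw [] v = word v
tshw (a ∷ u) [] = word (a ∷ u)
tshw (a ∷ u) (b ∷ v) =
  (((word (a ∷ []) ⊛ tshw u (b ∷ v)) ⊕ (word (b ∷ []) ⊛ tshw (a ∷ u) v))
    ⊖ scal (δ u) (ρ a ⊛ word (b ∷ v)))
    ⊖ scal (δ v) (ρ b ⊛ word (a ∷ u))

_⧢t_ : Ht → Ht → Ht
_⧢t_ = bilin tshw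

-- Both sides are ℚ[t]-bilinear in (w₁, w₂), so it suffices to treat words u, v, by induction
-- on |u| + |v|.  Write S_t(au) = (σ(a) − δ(u) ρ(a)) S_t(u): for u ≠ 1 this is the definition,
-- for u = 1 it is a = σ(a) − ρ(a).  For ℓ, m linear combinations of letters the shuffle obeys
-- ℓP ⧢ mQ = ℓ(P ⧢ mQ) + m(ℓP ⧢ Q), and S_t(ℓX) = σ(ℓ) S_t(X) when X has no constant term.
-- Applied to S_t(au) ⧢ S_t(bv), the correction terms δ(u) ρ(a) (S_t(u) ⧢ S_t(bv)) =
-- δ(u) ρ(a) S_t(bv) of the factors are exactly those of the t-shuffle, and the σ-terms match
-- S_t of its two recursive terms by induction.
--
-- Elements of h_t are lists of monomials, compared through their pairings with arbitrary
-- functionals ℕ → A* → ℚ on the basis t^k w; equal pairings give equal coefficients.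

module Submission where

open import Defs
open import Data.Bool using (true; false; if_then_else_; _∧_)
open import Data.List using ([]; _∷_; _++_; map; concatMap)
open import Data.List.Relation.Unary.All as All using (All; []; _∷_)
import Data.List.Relation.Unary.All.Properties as All
open import Data.Nat using (ℕ)
import Data.Nat as ℕ
import Data.Nat.Properties as ℕ
open import Data.Nat.Tactic.RingSolver using (solve-∀)
open import Data.Product using (_,_)
open import Data.Rational using (ℚ; 0ℚ; 1ℚ; -_; _+_; _*_)
import Data.Rational.Properties as ℚ
open import Data.Rational.Solver using (module +-*-Solver)
open +-*-Solver using (solve; _:+_; _:*_; :-_; _:-_; _:=_; con)
open import Function using (_∘_; id)
open import Level using (0ℓ)
open import Relation.Binary.Bundles using (Setoid)
import Relation.Binary.Reasoning.Setoid
open import Relation.Binary.PropositionalEquality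
open import Relation.Nullary.Decidable using (does)

Functional : Set
Functional = ℕ → Word → ℚ

pairing : Ht → Functional → ℚ
pairing [] φ = 0ℚ
pairing ((q , k , w) ∷ p) φ = q * φ k w + pairing p φ

infix 5 pairing
syntax pairing p (λ k w → e) = ∑[ k , w ∈ p ] e

infix 4 _≋_
record _≋_ (p r : Ht) : Set where
  constructor pairing-≡
  field at : ∀ φ → pairing p φ ≡ pairing r φ
open _≋_

≋-setoid : Setoid 0ℓ 0ℓ
≋-setoid = record
  { Carrier = Ht
  ; _≈_ = _≋_
  ; isEquivalence = record
    { refl = pairing-≡ λ _ → refl
    ; sym = λ e → pairing-≡ λ φ → sym (at e φ)
    ; trans = λ e f → pairing-≡ λ φ → trans (at e φ) (at f φ)
    }
  }

open Setoid ≋-setoid using () renaming (refl to ≋-refl; sym to ≋-sym; trans to ≋-trans)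
module ≋-Reasoning = Relation.Binary.Reasoning.Setoid ≋-setoid

indicator : ℕ → Word → Functional
indicator k u j w = if does (j ℕ.≟ k) ∧ (w ≟W u) then 1ℚ else 0ℚ

coeff≡pairing-indicator : ∀ p k u → coeff p k u ≡ pairing p (indicator k u)
coeff≡pairing-indicator [] k u = refl
coeff≡pairing-indicator ((q , j , w) ∷ p) k u =
  cong₂ _+_ (select (does (j ℕ.≟ k) ∧ (w ≟W u))) (coeff≡pairing-indicator p k u)
  where
  select : ∀ b → (if b then q else 0ℚ) ≡ q * (if b then 1ℚ else 0ℚ)
  select true = sym (ℚ.*-identityʳ q)
  select false = sym (ℚ.*-zeroʳ q)

≋⇒≈ : ∀ {p r} → p ≋ r → p ≈ r
≋⇒≈ {p} {r} e k u =
  trans (coeff≡pairing-indicator p k u) (trans (at e _) (sym (coeff≡pairing-indicator r k u)))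

pairing-cong : ∀ {φ ψ : Functional} → (∀ k w → φ k w ≡ ψ k w) → ∀ p → pairing p φ ≡ pairing p ψ
pairing-cong e [] = refl
pairing-cong e ((q , k , w) ∷ p) = cong₂ _+_ (cong (q *_) (e k w)) (pairing-cong e p)

wordOf : Term → Word
wordOf (_ , _ , w) = w

AllWords : (Word → Set) → Ht → Set
AllWords P = All (P ∘ wordOf)

pairing-congᴬ : ∀ {P : Word → Set} {φ ψ : Functional} → (∀ k w → P w → φ k w ≡ ψ k w) →
  ∀ {p} → AllWords P p → pairing p φ ≡ pairing p ψ
pairing-congᴬ e [] = refl
pairing-congᴬ e {(q , k , w) ∷ p} (pw ∷ ps) = cong₂ _+_ (cong (q *_) (e k w pw)) (pairing-congᴬ e ps)

pairing-++ : ∀ p r φ → pairing (p ++ r) φ ≡ pairing p φ + pairing r φ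
pairing-++ [] r φ = sym (ℚ.+-identityˡ _)
pairing-++ ((q , k , w) ∷ p) r φ =
  trans (cong (q * φ k w +_) (pairing-++ p r φ)) (sym (ℚ.+-assoc (q * φ k w) (pairing p φ) (pairing r φ)))

pairing-negate : ∀ p φ → pairing (negate p) φ ≡ - pairing p φ
pairing-negate [] φ = refl
pairing-negate ((q , k , w) ∷ p) φ =
  trans (cong₂ _+_ (sym (ℚ.neg-distribˡ-* q (φ k w))) (pairing-negate p φ))
        (sym (ℚ.neg-distrib-+ (q * φ k w) (pairing p φ)))

pairing-map : ∀ (g : Term → Term) c (h : ℕ → ℕ) (m : Word → Word) →
  (∀ q k w → g (q , k , w) ≡ (c * q , h k , m w)) →
  ∀ p φ → pairing (map g p) φ ≡ c * (∑[ k , w ∈ p ] φ (h k) (m w))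
pairing-map g c h m g≡ [] φ = sym (ℚ.*-zeroʳ c)
pairing-map g c h m g≡ ((q , k , w) ∷ p) φ rewrite g≡ q k w =
  trans (cong (c * q * φ (h k) (m w) +_) (pairing-map g c h m g≡ p φ))
        (factor c q (φ (h k) (m w)) _)
  where
  factor : ∀ c q a s → c * q * a + c * s ≡ c * (q * a + s)
  factor = solve 4 (λ c q a s → c :* q :* a :+ c :* s := c :* (q :* a :+ s)) refl

pairing-scal : ∀ c p φ → pairing (scal c p) φ ≡ c * pairing p φ
pairing-scal c = pairing-map _ c id id (λ _ _ _ → refl)

pairing-word : ∀ w φ → pairing (word w) φ ≡ φ 0 w
pairing-word w φ = trans (ℚ.+-identityʳ _) (ℚ.*-identityˡ _)

pairing-+ : ∀ p (φ ψ : Functional) → ∑[ k , w ∈ p ] (φ k w + ψ k w) ≡ pairing p φ + pairing p ψ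
pairing-+ [] φ ψ = sym (ℚ.+-identityˡ 0ℚ)
pairing-+ ((q , k , w) ∷ p) φ ψ =
  trans (cong (q * (φ k w + ψ k w) +_) (pairing-+ p φ ψ)) (interchange q (φ k w) (ψ k w) _ _)
  where
  interchange : ∀ q a b s t → q * (a + b) + (s + t) ≡ (q * a + s) + (q * b + t)
  interchange = solve 5 (λ q a b s t → q :* (a :+ b) :+ (s :+ t) := (q :* a :+ s) :+ (q :* b :+ t)) refl

pairing-* : ∀ p c (φ : Functional) → ∑[ k , w ∈ p ] c * φ k w ≡ c * pairing p φ
pairing-* [] c φ = sym (ℚ.*-zeroʳ c)
pairing-* ((q , k , w) ∷ p) c φ =
  trans (cong (q * (c * φ k w) +_) (pairing-* p c φ)) (factor q c (φ k w) _)
  where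
  factor : ∀ q c a s → q * (c * a) + c * s ≡ c * (q * a + s)
  factor = solve 4 (λ q c a s → q :* (c :* a) :+ c :* s := c :* (q :* a :+ s)) refl

pairing-0 : ∀ p → ∑[ k , w ∈ p ] 0ℚ ≡ 0ℚ
pairing-0 [] = refl
pairing-0 ((q , k , w) ∷ p) = trans (cong₂ _+_ (ℚ.*-zeroʳ q) (pairing-0 p)) (ℚ.+-identityˡ 0ℚ)

pairing-swap : ∀ p r (F : ℕ → Word → Functional) →
  ∑[ k , u ∈ p ] ∑[ j , v ∈ r ] F k u j v ≡ ∑[ j , v ∈ r ] ∑[ k , u ∈ p ] F k u j v
pairing-swap [] r F = sym (pairing-0 r)
pairing-swap ((q , k , u) ∷ p) r F = begin
  q * pairing r (F k u) + (∑[ k′ , u′ ∈ p ] ∑[ j , v ∈ r ] F k′ u′ j v)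
    ≡⟨ cong₂ _+_ (sym (pairing-* r q (F k u))) (pairing-swap p r F) ⟩
  (∑[ j , v ∈ r ] q * F k u j v) + (∑[ j , v ∈ r ] ∑[ k′ , u′ ∈ p ] F k′ u′ j v)
    ≡⟨ sym (pairing-+ r _ _) ⟩
  (∑[ j , v ∈ r ] (q * F k u j v + (∑[ k′ , u′ ∈ p ] F k′ u′ j v))) ∎
  where open ≡-Reasoning

pairing-concatMap : ∀ (G : Term → Ht) (φ ψ : Functional) →
  (∀ q k w → pairing (G (q , k , w)) φ ≡ q * ψ k w) → ∀ p → pairing (concatMap G p) φ ≡ pairing p ψ
pairing-concatMap G φ ψ G≡ [] = refl
pairing-concatMap G φ ψ G≡ ((q , k , w) ∷ p) =
  trans (pairing-++ (G (q , k , w)) (concatMap G p) φ) (cong₂ _+_ (G≡ q k w) (pairing-concatMap G φ ψ G≡ p))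

pairing-⊛ : ∀ p r φ → pairing (p ⊛ r) φ ≡ ∑[ k₁ , u ∈ p ] ∑[ k₂ , v ∈ r ] φ (k₁ ℕ.+ k₂) (u ++ v)
pairing-⊛ p r φ = pairing-concatMap _ φ _
  (λ q₁ k₁ u → pairing-map _ q₁ (k₁ ℕ.+_) (u ++_) (λ _ _ _ → refl) r φ) p

pairing-lin : ∀ f p φ → pairing (lin f p) φ ≡ ∑[ k₁ , u ∈ p ] ∑[ k , w ∈ f u ] φ (k₁ ℕ.+ k) w
pairing-lin f p φ = pairing-concatMap _ φ _
  (λ q₁ k₁ u → pairing-map _ q₁ (k₁ ℕ.+_) id (λ _ _ _ → refl) (f u) φ) p

pairing-bilin : ∀ f p r φ →
  pairing (bilin f p r) φ ≡ ∑[ k₁ , u ∈ p ] ∑[ k₂ , v ∈ r ] ∑[ k , w ∈ f u v ] φ (k₁ ℕ.+ k₂ ℕ.+ k) w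
pairing-bilin f p r φ = pairing-concatMap _ φ _ inner p
  where
  inner : ∀ q₁ k₁ u → _
  inner q₁ k₁ u = trans
    (pairing-concatMap _ φ (λ k₂ v → q₁ * (∑[ k , w ∈ f u v ] φ (k₁ ℕ.+ k₂ ℕ.+ k) w))
      (λ q₂ k₂ v → trans (pairing-map _ (q₁ * q₂) (k₁ ℕ.+ k₂ ℕ.+_) id (λ _ _ _ → refl) (f u v) φ)
                         (reassoc q₁ q₂ _)) r)
    (pairing-* r q₁ _)
    where
    reassoc : ∀ a b s → a * b * s ≡ b * (a * s)
    reassoc = solve 3 (λ a b s → a :* b :* s := b :* (a :* s)) refl

pairing-⊖-scal : ∀ p c r φ → pairing (p ⊖ scal c r) φ ≡ pairing p φ + - (c * pairing r φ)
pairing-⊖-scal p c r φ = trans (pairing-++ p (negate (scal c r)) φ)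
  (cong (pairing p φ +_) (trans (pairing-negate (scal c r) φ) (cong -_ (pairing-scal c r φ))))

⊕-cong : ∀ {p p′ r r′} → p ≋ p′ → r ≋ r′ → p ⊕ r ≋ p′ ⊕ r′
⊕-cong {p} {p′} {r} {r′} e f = pairing-≡ λ φ →
  trans (pairing-++ p r φ) (trans (cong₂ _+_ (at e φ) (at f φ)) (sym (pairing-++ p′ r′ φ)))

⊖-cong : ∀ {p p′ r r′} → p ≋ p′ → r ≋ r′ → p ⊖ r ≋ p′ ⊖ r′
⊖-cong {r = r} {r′} e f = ⊕-cong e (pairing-≡ λ φ →
  trans (pairing-negate r φ) (trans (cong -_ (at f φ)) (sym (pairing-negate r′ φ))))

scal-cong : ∀ c {p p′} → p ≋ p′ → scal c p ≋ scal c p′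
scal-cong c {p} {p′} e = pairing-≡ λ φ →
  trans (pairing-scal c p φ) (trans (cong (c *_) (at e φ)) (sym (pairing-scal c p′ φ)))

scal-zero : ∀ p → scal 0ℚ p ≋ []
scal-zero p = pairing-≡ λ φ → trans (pairing-scal 0ℚ p φ) (ℚ.*-zeroˡ (pairing p φ))

⊛-cong : ∀ {L L′ P P′} → L ≋ L′ → P ≋ P′ → L ⊛ P ≋ L′ ⊛ P′
⊛-cong {L} {L′} {P} {P′} e f = pairing-≡ λ φ → begin
  pairing (L ⊛ P) φ                                     ≡⟨ pairing-⊛ L P φ ⟩
  ∑[ k₁ , u ∈ L ] ∑[ k₂ , v ∈ P ] φ (k₁ ℕ.+ k₂) (u ++ v)  ≡⟨ pairing-cong (λ k₁ u → at f _) L ⟩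
  ∑[ k₁ , u ∈ L ] ∑[ k₂ , v ∈ P′ ] φ (k₁ ℕ.+ k₂) (u ++ v) ≡⟨ at e _ ⟩
  ∑[ k₁ , u ∈ L′ ] ∑[ k₂ , v ∈ P′ ] φ (k₁ ℕ.+ k₂) (u ++ v) ≡⟨ sym (pairing-⊛ L′ P′ φ) ⟩
  pairing (L′ ⊛ P′) φ                                    ∎
  where open ≡-Reasoning

⊛-distribʳ-⊖-scal : ∀ L c M X → (L ⊖ scal c M) ⊛ X ≋ (L ⊛ X) ⊖ scal c (M ⊛ X)
⊛-distribʳ-⊖-scal L c M X = pairing-≡ λ φ → begin
  pairing ((L ⊖ scal c M) ⊛ X) φ                 ≡⟨ pairing-⊛ (L ⊖ scal c M) X φ ⟩
  pairing (L ⊖ scal c M) (ψ φ)                   ≡⟨ pairing-⊖-scal L c M (ψ φ) ⟩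
  pairing L (ψ φ) + - (c * pairing M (ψ φ))
    ≡⟨ sym (cong₂ (λ a b → a + - (c * b)) (pairing-⊛ L X φ) (pairing-⊛ M X φ)) ⟩
  pairing (L ⊛ X) φ + - (c * pairing (M ⊛ X) φ)  ≡⟨ sym (pairing-⊖-scal (L ⊛ X) c (M ⊛ X) φ) ⟩
  pairing ((L ⊛ X) ⊖ scal c (M ⊛ X)) φ           ∎
  where
  open ≡-Reasoning
  ψ : Functional → Functional
  ψ φ k₁ u = ∑[ k₂ , v ∈ X ] φ (k₁ ℕ.+ k₂) (u ++ v)

⊖-⊕-interchange : ∀ A B C D → (A ⊖ C) ⊕ (B ⊖ D) ≋ ((A ⊕ B) ⊖ C) ⊖ D
⊖-⊕-interchange A B C D = pairing-≡ λ φ → begin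
  pairing ((A ⊖ C) ⊕ (B ⊖ D)) φ
    ≡⟨ trans (pairing-++ (A ⊖ C) (B ⊖ D) φ) (cong₂ _+_ (pairing-⊖ A C φ) (pairing-⊖ B D φ)) ⟩
  (pairing A φ + - pairing C φ) + (pairing B φ + - pairing D φ)
    ≡⟨ interchange (pairing A φ) (pairing B φ) (pairing C φ) (pairing D φ) ⟩
  (pairing A φ + pairing B φ) + - pairing C φ + - pairing D φ
    ≡⟨ sym (trans (pairing-⊖ ((A ⊕ B) ⊖ C) D φ)
             (cong (_+ - pairing D φ) (trans (pairing-⊖ (A ⊕ B) C φ)
               (cong (_+ - pairing C φ) (pairing-++ A B φ))))) ⟩
  pairing (((A ⊕ B) ⊖ C) ⊖ D) φ ∎
  where
  open ≡-Reasoning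
  pairing-⊖ : ∀ p r φ → pairing (p ⊖ r) φ ≡ pairing p φ + - pairing r φ
  pairing-⊖ p r φ = trans (pairing-++ p (negate r) φ) (cong (pairing p φ +_) (pairing-negate r φ))
  interchange : ∀ a b c d → (a + - c) + (b + - d) ≡ (a + b) + - c + - d
  interchange = solve 4 (λ a b c d → (a :- c) :+ (b :- d) := (a :+ b) :- c :- d) refl

lin-⊕ : ∀ f p r → lin f (p ⊕ r) ≋ lin f p ⊕ lin f r
lin-⊕ f p r = pairing-≡ λ φ → begin
  pairing (lin f (p ⊕ r)) φ                  ≡⟨ pairing-lin f (p ⊕ r) φ ⟩
  pairing (p ⊕ r) (ψ φ)                      ≡⟨ pairing-++ p r (ψ φ) ⟩
  pairing p (ψ φ) + pairing r (ψ φ)          ≡⟨ sym (cong₂ _+_ (pairing-lin f p φ) (pairing-lin f r φ)) ⟩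
  pairing (lin f p) φ + pairing (lin f r) φ  ≡⟨ sym (pairing-++ (lin f p) (lin f r) φ) ⟩
  pairing (lin f p ⊕ lin f r) φ              ∎
  where
  open ≡-Reasoning
  ψ : Functional → Functional
  ψ φ k₁ u = ∑[ k , w ∈ f u ] φ (k₁ ℕ.+ k) w

lin-⊖-scal : ∀ f p c r → lin f (p ⊖ scal c r) ≋ lin f p ⊖ scal c (lin f r)
lin-⊖-scal f p c r = pairing-≡ λ φ → begin
  pairing (lin f (p ⊖ scal c r)) φ                  ≡⟨ pairing-lin f (p ⊖ scal c r) φ ⟩
  pairing (p ⊖ scal c r) (ψ φ)                      ≡⟨ pairing-⊖-scal p c r (ψ φ) ⟩
  pairing p (ψ φ) + - (c * pairing r (ψ φ))
    ≡⟨ sym (cong₂ (λ a b → a + - (c * b)) (pairing-lin f p φ) (pairing-lin f r φ)) ⟩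
  pairing (lin f p) φ + - (c * pairing (lin f r) φ) ≡⟨ sym (pairing-⊖-scal (lin f p) c (lin f r) φ) ⟩
  pairing (lin f p ⊖ scal c (lin f r)) φ            ∎
  where
  open ≡-Reasoning
  ψ : Functional → Functional
  ψ φ k₁ u = ∑[ k , w ∈ f u ] φ (k₁ ℕ.+ k) w

lin-word : ∀ f w → lin f (word w) ≋ f w
lin-word f w = pairing-≡ λ φ →
  trans (pairing-lin f (word w) φ) (pairing-word w (λ k₁ u → ∑[ k , z ∈ f u ] φ (k₁ ℕ.+ k) z))

bilin-cong : ∀ f {p p′ r r′} → p ≋ p′ → r ≋ r′ → bilin f p r ≋ bilin f p′ r′
bilin-cong f {p} {p′} {r} {r′} e e′ = pairing-≡ λ φ →
  trans (pairing-bilin f p r φ)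
    (trans (pairing-cong (λ k₁ u → at e′ _) p)
      (trans (at e _) (sym (pairing-bilin f p′ r′ φ))))

bilin-congᶠ : ∀ {f g} → (∀ u v → f u v ≋ g u v) → ∀ p r → bilin f p r ≋ bilin g p r
bilin-congᶠ {f} {g} e p r = pairing-≡ λ φ →
  trans (pairing-bilin f p r φ)
    (trans (pairing-cong (λ k₁ u → pairing-cong (λ k₂ v → at (e u v) _) r) p)
      (sym (pairing-bilin g p r φ)))

lin-bilin : ∀ g f p r → lin g (bilin f p r) ≋ bilin (λ u v → lin g (f u v)) p r
lin-bilin g f p r = pairing-≡ λ φ → begin
  pairing (lin g (bilin f p r)) φ
    ≡⟨ trans (pairing-lin g (bilin f p r) φ) (pairing-bilin f p r _) ⟩
  ∑[ k₁ , u ∈ p ] ∑[ k₂ , v ∈ r ] ∑[ k , w ∈ f u v ] ∑[ j , z ∈ g w ] φ (k₁ ℕ.+ k₂ ℕ.+ k ℕ.+ j) z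
    ≡⟨ pairing-cong (λ k₁ u → pairing-cong (λ k₂ v → pairing-cong (λ k w → pairing-cong (λ j z →
         cong (λ n → φ n z) (ℕ.+-assoc (k₁ ℕ.+ k₂) k j)) (g w)) (f u v)) r) p ⟩
  ∑[ k₁ , u ∈ p ] ∑[ k₂ , v ∈ r ] ∑[ k , w ∈ f u v ] ∑[ j , z ∈ g w ] φ (k₁ ℕ.+ k₂ ℕ.+ (k ℕ.+ j)) z
    ≡⟨ sym (pairing-cong (λ k₁ u → pairing-cong (λ k₂ v → pairing-lin g (f u v) _) r) p) ⟩
  ∑[ k₁ , u ∈ p ] ∑[ k₂ , v ∈ r ] ∑[ m , z ∈ lin g (f u v) ] φ (k₁ ℕ.+ k₂ ℕ.+ m) z
    ≡⟨ sym (pairing-bilin (λ u v → lin g (f u v)) p r φ) ⟩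
  pairing (bilin (λ u v → lin g (f u v)) p r) φ ∎
  where open ≡-Reasoning

bilin-lin : ∀ f g h p r → bilin f (lin g p) (lin h r) ≋ bilin (λ u v → bilin f (g u) (h v)) p r
bilin-lin f g h p r = pairing-≡ λ φ → begin
  pairing (bilin f (lin g p) (lin h r)) φ
    ≡⟨ trans (pairing-bilin f (lin g p) (lin h r) φ)
         (trans (pairing-lin g p _)
           (pairing-cong (λ i u → pairing-cong (λ i′ s → pairing-lin h r _) (g u)) p)) ⟩
  ∑[ i , u ∈ p ] ∑[ i′ , s ∈ g u ] ∑[ j , v ∈ r ] ∑[ j′ , t ∈ h v ] ∑[ k , z ∈ f s t ]
    φ (i ℕ.+ i′ ℕ.+ (j ℕ.+ j′) ℕ.+ k) z
    ≡⟨ pairing-cong (λ i u → pairing-swap (g u) r _) p ⟩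
  ∑[ i , u ∈ p ] ∑[ j , v ∈ r ] ∑[ i′ , s ∈ g u ] ∑[ j′ , t ∈ h v ] ∑[ k , z ∈ f s t ]
    φ (i ℕ.+ i′ ℕ.+ (j ℕ.+ j′) ℕ.+ k) z
    ≡⟨ pairing-cong (λ i u → pairing-cong (λ j v → pairing-cong (λ i′ s → pairing-cong (λ j′ t →
         pairing-cong (λ k z → cong (λ n → φ n z) (regroup i i′ j j′ k)) (f s t)) (h v)) (g u)) r) p ⟩
  ∑[ i , u ∈ p ] ∑[ j , v ∈ r ] ∑[ i′ , s ∈ g u ] ∑[ j′ , t ∈ h v ] ∑[ k , z ∈ f s t ]
    φ (i ℕ.+ j ℕ.+ (i′ ℕ.+ j′ ℕ.+ k)) z
    ≡⟨ sym (trans (pairing-bilin _ p r φ)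
         (pairing-cong (λ i u → pairing-cong (λ j v → pairing-bilin f (g u) (h v) _) r) p)) ⟩
  pairing (bilin (λ u v → bilin f (g u) (h v)) p r) φ ∎
  where
  open ≡-Reasoning
  regroup : ∀ i i′ j j′ k → i ℕ.+ i′ ℕ.+ (j ℕ.+ j′) ℕ.+ k ≡ i ℕ.+ j ℕ.+ (i′ ℕ.+ j′ ℕ.+ k)
  regroup = solve-∀

one-⧢ : ∀ P → one ⧢ P ≋ P
one-⧢ P = pairing-≡ λ φ → begin
  pairing (one ⧢ P) φ                                      ≡⟨ pairing-bilin shw one P φ ⟩
  1ℚ * (∑[ k₂ , v ∈ P ] ∑[ k , w ∈ word v ] φ (k₂ ℕ.+ k) w) + 0ℚ
    ≡⟨ trans (ℚ.+-identityʳ _) (ℚ.*-identityˡ _) ⟩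
  ∑[ k₂ , v ∈ P ] ∑[ k , w ∈ word v ] φ (k₂ ℕ.+ k) w
    ≡⟨ pairing-cong (λ k₂ v → trans (pairing-word v (λ k w → φ (k₂ ℕ.+ k) w))
                                    (cong (λ n → φ n v) (ℕ.+-identityʳ k₂))) P ⟩
  pairing P φ                                              ∎
  where open ≡-Reasoning

shw-identityʳ : ∀ w → shw w [] ≡ word w
shw-identityʳ [] = refl
shw-identityʳ (a ∷ w) = refl

⧢-one : ∀ P → P ⧢ one ≋ P
⧢-one P = pairing-≡ λ φ → trans (pairing-bilin shw P one φ) (pairing-cong (λ k₁ u → begin
  1ℚ * (∑[ k , w ∈ shw u [] ] φ (k₁ ℕ.+ 0 ℕ.+ k) w) + 0ℚ  ≡⟨ trans (ℚ.+-identityʳ _) (ℚ.*-identityˡ _) ⟩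
  ∑[ k , w ∈ shw u [] ] φ (k₁ ℕ.+ 0 ℕ.+ k) w              ≡⟨ cong (λ s → pairing s _) (shw-identityʳ u) ⟩
  ∑[ k , w ∈ word u ] φ (k₁ ℕ.+ 0 ℕ.+ k) w                ≡⟨ pairing-word u (λ k w → φ (k₁ ℕ.+ 0 ℕ.+ k) w) ⟩
  φ (k₁ ℕ.+ 0 ℕ.+ 0) u                                    ≡⟨ cong (λ n → φ n u) (drop-zeros k₁) ⟩
  φ k₁ u                                                   ∎) P)
  where
  open ≡-Reasoning
  drop-zeros : ∀ k → k ℕ.+ 0 ℕ.+ 0 ≡ k
  drop-zeros = solve-∀

data IsLetter : Word → Set where
  letter : ∀ c → IsLetter (c ∷ [])

data IsNonEmpty : Word → Set where
  nonEmpty : ∀ c w → IsNonEmpty (c ∷ w)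

AllWords-⊖-scal : ∀ {P : Word → Set} {p r} c → AllWords P p → AllWords P r → AllWords P (p ⊖ scal c r)
AllWords-⊖-scal c ps rs = All.++⁺ ps (All.map⁺ (All.map⁺ rs))

σL-letters : ∀ a → AllWords IsLetter (σL a)
σL-letters x = letter x ∷ []
σL-letters y = letter x ∷ letter y ∷ []

ρ-letters : ∀ a → AllWords IsLetter (ρ a)
ρ-letters x = []
ρ-letters y = letter x ∷ []

⊛-nonEmpty : ∀ L X → AllWords IsLetter L → AllWords IsNonEmpty (L ⊛ X)
⊛-nonEmpty [] X [] = []
⊛-nonEmpty ((q , k , _) ∷ L) X (letter c ∷ ls) =
  All.++⁺ (All.map⁺ (All.universal (λ t → nonEmpty c (wordOf t)) X)) (⊛-nonEmpty L X ls)

tshw-nonEmpty : ∀ a u b v → AllWords IsNonEmpty (tshw (a ∷ u) (b ∷ v))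
tshw-nonEmpty a u b v =
  AllWords-⊖-scal (δ v)
    (AllWords-⊖-scal (δ u)
      (All.++⁺ (⊛-nonEmpty (word (a ∷ [])) (tshw u (b ∷ v)) (letter a ∷ []))
               (⊛-nonEmpty (word (b ∷ [])) (tshw (a ∷ u) v) (letter b ∷ [])))
      (⊛-nonEmpty (ρ a) (word (b ∷ v)) (ρ-letters a)))
    (⊛-nonEmpty (ρ b) (word (a ∷ u)) (ρ-letters b))

tshw-nonEmptyˡ : ∀ u b v → AllWords IsNonEmpty (tshw u (b ∷ v))
tshw-nonEmptyˡ [] b v = nonEmpty b v ∷ []
tshw-nonEmptyˡ (a ∷ u) b v = tshw-nonEmpty a u b v

tshw-nonEmptyʳ : ∀ a u v → AllWords IsNonEmpty (tshw (a ∷ u) v)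
tshw-nonEmptyʳ a u [] = nonEmpty a u ∷ []
tshw-nonEmptyʳ a u (b ∷ v) = tshw-nonEmpty a u b v

-- σ_t on single-letter words; the value on other words is never used.
σ₁ : Word → Ht
σ₁ [] = []
σ₁ (c ∷ _) = σL c

S-⊛ : ∀ {L X} → AllWords IsLetter L → AllWords IsNonEmpty X → S (L ⊛ X) ≋ lin σ₁ L ⊛ S X
S-⊛ {L} {X} ls ns = pairing-≡ λ φ → begin
  pairing (S (L ⊛ X)) φ
    ≡⟨ trans (pairing-lin Sw (L ⊛ X) φ) (pairing-⊛ L X _) ⟩
  ∑[ i , ℓ ∈ L ] ∑[ j , w ∈ X ] ∑[ k , z ∈ Sw (ℓ ++ w) ] φ (i ℕ.+ j ℕ.+ k) z
    ≡⟨ pairing-congᴬ (λ i ℓ isℓ → pairing-congᴬ (λ j w isw → Sw-++ φ i j isℓ isw) ns) ls ⟩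
  ∑[ i , ℓ ∈ L ] ∑[ j , w ∈ X ] ∑[ i′ , s ∈ σ₁ ℓ ] ∑[ j′ , z ∈ Sw w ] φ (i ℕ.+ j ℕ.+ (i′ ℕ.+ j′)) (s ++ z)
    ≡⟨ pairing-cong (λ i ℓ → pairing-swap X (σ₁ ℓ) _) L ⟩
  ∑[ i , ℓ ∈ L ] ∑[ i′ , s ∈ σ₁ ℓ ] ∑[ j , w ∈ X ] ∑[ j′ , z ∈ Sw w ] φ (i ℕ.+ j ℕ.+ (i′ ℕ.+ j′)) (s ++ z)
    ≡⟨ pairing-cong (λ i ℓ → pairing-cong (λ i′ s → pairing-cong (λ j w → pairing-cong (λ j′ z →
         cong (λ n → φ n (s ++ z)) (regroup i j i′ j′)) (Sw w)) X) (σ₁ ℓ)) L ⟩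
  ∑[ i , ℓ ∈ L ] ∑[ i′ , s ∈ σ₁ ℓ ] ∑[ j , w ∈ X ] ∑[ j′ , z ∈ Sw w ] φ (i ℕ.+ i′ ℕ.+ (j ℕ.+ j′)) (s ++ z)
    ≡⟨ sym (trans (pairing-⊛ (lin σ₁ L) (S X) φ) (trans (pairing-lin σ₁ L _)
         (pairing-cong (λ i ℓ → pairing-cong (λ i′ s → pairing-lin Sw X _) (σ₁ ℓ)) L))) ⟩
  pairing (lin σ₁ L ⊛ S X) φ ∎
  where
  open ≡-Reasoning
  regroup : ∀ i j i′ j′ → i ℕ.+ j ℕ.+ (i′ ℕ.+ j′) ≡ i ℕ.+ i′ ℕ.+ (j ℕ.+ j′)
  regroup = solve-∀
  Sw-++ : ∀ φ i j {ℓ w} → IsLetter ℓ → IsNonEmpty w →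
    ∑[ k , z ∈ Sw (ℓ ++ w) ] φ (i ℕ.+ j ℕ.+ k) z ≡
    ∑[ i′ , s ∈ σ₁ ℓ ] ∑[ j′ , z ∈ Sw w ] φ (i ℕ.+ j ℕ.+ (i′ ℕ.+ j′)) (s ++ z)
  Sw-++ φ i j (letter c) (nonEmpty d w) = pairing-⊛ (σL c) (Sw (d ∷ w)) _

lin-σ₁-ρ : ∀ a → lin σ₁ (ρ a) ≋ ρ a
lin-σ₁-ρ x = ≋-refl
lin-σ₁-ρ y = pairing-≡ λ φ → unit (φ 1 (x ∷ []))
  where
  unit : ∀ a → 1ℚ * 1ℚ * a + 0ℚ ≡ 1ℚ * a + 0ℚ
  unit = solve 1 (λ a → con 1ℚ :* con 1ℚ :* a :+ con 0ℚ := con 1ℚ :* a :+ con 0ℚ) refl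

S-letter-⊛ : ∀ a {X} → AllWords IsNonEmpty X → S (word (a ∷ []) ⊛ X) ≋ σL a ⊛ S X
S-letter-⊛ a ns = ≋-trans (S-⊛ {word (a ∷ [])} (letter a ∷ []) ns) (⊛-cong (lin-word σ₁ (a ∷ [])) ≋-refl)

S-ρ-⊛ : ∀ a {X} → AllWords IsNonEmpty X → S (ρ a ⊛ X) ≋ ρ a ⊛ S X
S-ρ-⊛ a ns = ≋-trans (S-⊛ (ρ-letters a) ns) (⊛-cong (lin-σ₁-ρ a) ≋-refl)

pairing-letter-⊛ : ∀ c A φ → pairing (word (c ∷ []) ⊛ A) φ ≡ ∑[ k , z ∈ A ] φ k (c ∷ z)
pairing-letter-⊛ c A φ = trans (pairing-⊛ (word (c ∷ [])) A φ) (trans (ℚ.+-identityʳ _) (ℚ.*-identityˡ _))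

pairing-shw-∷ : ∀ c d w w′ φ → pairing (shw (c ∷ w) (d ∷ w′)) φ ≡
  (∑[ k , z ∈ shw w (d ∷ w′) ] φ k (c ∷ z)) + (∑[ k , z ∈ shw (c ∷ w) w′ ] φ k (d ∷ z))
pairing-shw-∷ c d w w′ φ =
  trans (pairing-++ (word (c ∷ []) ⊛ shw w (d ∷ w′)) (word (d ∷ []) ⊛ shw (c ∷ w) w′) φ)
  (cong₂ _+_ (pairing-letter-⊛ c (shw w (d ∷ w′)) φ) (pairing-letter-⊛ d (shw (c ∷ w) w′) φ))

⧢-⊛-letters : ∀ {L M} P Q → AllWords IsLetter L → AllWords IsLetter M →
  (L ⊛ P) ⧢ (M ⊛ Q) ≋ (L ⊛ (P ⧢ (M ⊛ Q))) ⊕ (M ⊛ ((L ⊛ P) ⧢ Q))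
⧢-⊛-letters {L} {M} P Q ls ms = pairing-≡ λ φ → begin
  pairing ((L ⊛ P) ⧢ (M ⊛ Q)) φ
    ≡⟨ trans (pairing-bilin shw (L ⊛ P) (M ⊛ Q) φ) (trans (pairing-⊛ L P _)
         (pairing-cong (λ i ℓ → pairing-cong (λ j w → pairing-⊛ M Q _) P) L)) ⟩
  Σ₄ (λ i ℓ j w i′ m j′ w′ → ∑[ k , z ∈ shw (ℓ ++ w) (m ++ w′) ] φ (i ℕ.+ j ℕ.+ (i′ ℕ.+ j′) ℕ.+ k) z)
    ≡⟨ pairing-congᴬ (λ i ℓ isℓ → pairing-cong (λ j w → pairing-congᴬ (λ i′ m ism →
         pairing-cong (λ j′ w′ → split φ i j i′ j′ w w′ isℓ ism) Q) ms) P) ls ⟩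
  Σ₄ (λ i ℓ j w i′ m j′ w′ → first φ i ℓ j w i′ m j′ w′ + second φ i ℓ j w i′ m j′ w′)
    ≡⟨ Σ₄-+ (first φ) (second φ) ⟩
  Σ₄ (first φ) + Σ₄ (second φ)
    ≡⟨ sym (cong₂ _+_ (first-branch φ) (second-branch φ)) ⟩
  pairing (L ⊛ (P ⧢ (M ⊛ Q))) φ + pairing (M ⊛ ((L ⊛ P) ⧢ Q)) φ
    ≡⟨ sym (pairing-++ (L ⊛ (P ⧢ (M ⊛ Q))) (M ⊛ ((L ⊛ P) ⧢ Q)) φ) ⟩
  pairing ((L ⊛ (P ⧢ (M ⊛ Q))) ⊕ (M ⊛ ((L ⊛ P) ⧢ Q))) φ ∎
  where
  open ≡-Reasoning

  Summand : Set
  Summand = ℕ → Word → ℕ → Word → ℕ → Word → ℕ → Word → ℚ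

  Σ₄ : Summand → ℚ
  Σ₄ F = ∑[ i , ℓ ∈ L ] ∑[ j , w ∈ P ] ∑[ i′ , m ∈ M ] ∑[ j′ , w′ ∈ Q ] F i ℓ j w i′ m j′ w′

  Σ₄-cong : ∀ {F G : Summand} → (∀ i ℓ j w i′ m j′ w′ → F i ℓ j w i′ m j′ w′ ≡ G i ℓ j w i′ m j′ w′) →
    Σ₄ F ≡ Σ₄ G
  Σ₄-cong F≡G = pairing-cong (λ i ℓ → pairing-cong (λ j w → pairing-cong (λ i′ m →
    pairing-cong (λ j′ w′ → F≡G i ℓ j w i′ m j′ w′) Q) M) P) L

  Σ₄-+ : ∀ (F G : Summand) →
    Σ₄ (λ i ℓ j w i′ m j′ w′ → F i ℓ j w i′ m j′ w′ + G i ℓ j w i′ m j′ w′) ≡ Σ₄ F + Σ₄ G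
  Σ₄-+ F G = trans (pairing-cong (λ i ℓ → trans (pairing-cong (λ j w → trans (pairing-cong (λ i′ m →
    pairing-+ Q _ _) M) (pairing-+ M _ _)) P) (pairing-+ P _ _)) L) (pairing-+ L _ _)

  first second : Functional → Summand
  first φ i ℓ j w i′ m j′ w′ = ∑[ k , z ∈ shw w (m ++ w′) ] φ (i ℕ.+ j ℕ.+ (i′ ℕ.+ j′) ℕ.+ k) (ℓ ++ z)
  second φ i ℓ j w i′ m j′ w′ = ∑[ k , z ∈ shw (ℓ ++ w) w′ ] φ (i ℕ.+ j ℕ.+ (i′ ℕ.+ j′) ℕ.+ k) (m ++ z)

  split : ∀ φ i j i′ j′ w w′ {ℓ m} → IsLetter ℓ → IsLetter m →
    ∑[ k , z ∈ shw (ℓ ++ w) (m ++ w′) ] φ (i ℕ.+ j ℕ.+ (i′ ℕ.+ j′) ℕ.+ k) z ≡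
    first φ i ℓ j w i′ m j′ w′ + second φ i ℓ j w i′ m j′ w′
  split φ i j i′ j′ w w′ (letter c) (letter d) = pairing-shw-∷ c d w w′ _

  first-branch : ∀ φ → pairing (L ⊛ (P ⧢ (M ⊛ Q))) φ ≡ Σ₄ (first φ)
  first-branch φ = begin
    pairing (L ⊛ (P ⧢ (M ⊛ Q))) φ
      ≡⟨ trans (pairing-⊛ L (P ⧢ (M ⊛ Q)) φ) (pairing-cong (λ i ℓ →
           trans (pairing-bilin shw P (M ⊛ Q) _) (pairing-cong (λ j w → pairing-⊛ M Q _) P)) L) ⟩
    Σ₄ (λ i ℓ j w i′ m j′ w′ →
      ∑[ k , z ∈ shw w (m ++ w′) ] φ (i ℕ.+ (j ℕ.+ (i′ ℕ.+ j′) ℕ.+ k)) (ℓ ++ z))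
      ≡⟨ Σ₄-cong (λ i ℓ j w i′ m j′ w′ → pairing-cong (λ k z →
           cong (λ n → φ n (ℓ ++ z)) (regroup i j i′ j′ k)) (shw w (m ++ w′))) ⟩
    Σ₄ (first φ) ∎
    where
    regroup : ∀ i j i′ j′ k → i ℕ.+ (j ℕ.+ (i′ ℕ.+ j′) ℕ.+ k) ≡ i ℕ.+ j ℕ.+ (i′ ℕ.+ j′) ℕ.+ k
    regroup = solve-∀

  second-branch : ∀ φ → pairing (M ⊛ ((L ⊛ P) ⧢ Q)) φ ≡ Σ₄ (second φ)
  second-branch φ = begin
    pairing (M ⊛ ((L ⊛ P) ⧢ Q)) φ
      ≡⟨ trans (pairing-⊛ M ((L ⊛ P) ⧢ Q) φ) (pairing-cong (λ i′ m →
           trans (pairing-bilin shw (L ⊛ P) Q _) (pairing-⊛ L P _)) M) ⟩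
    ∑[ i′ , m ∈ M ] ∑[ i , ℓ ∈ L ] ∑[ j , w ∈ P ] ∑[ j′ , w′ ∈ Q ] ∑[ k , z ∈ shw (ℓ ++ w) w′ ]
      φ (i′ ℕ.+ (i ℕ.+ j ℕ.+ j′ ℕ.+ k)) (m ++ z)
      ≡⟨ trans (pairing-swap M L _) (pairing-cong (λ i ℓ → pairing-swap M P _) L) ⟩
    Σ₄ (λ i ℓ j w i′ m j′ w′ →
      ∑[ k , z ∈ shw (ℓ ++ w) w′ ] φ (i′ ℕ.+ (i ℕ.+ j ℕ.+ j′ ℕ.+ k)) (m ++ z))
      ≡⟨ Σ₄-cong (λ i ℓ j w i′ m j′ w′ → pairing-cong (λ k z →
           cong (λ n → φ n (m ++ z)) (regroup i j i′ j′ k)) (shw (ℓ ++ w) w′)) ⟩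
    Σ₄ (second φ) ∎
    where
    regroup : ∀ i j i′ j′ k → i′ ℕ.+ (i ℕ.+ j ℕ.+ j′ ℕ.+ k) ≡ i ℕ.+ j ℕ.+ (i′ ℕ.+ j′) ℕ.+ k
    regroup = solve-∀

⊖-scal-zero : ∀ p r → p ⊖ scal 0ℚ r ≋ p
⊖-scal-zero p r = pairing-≡ λ φ → trans (pairing-⊖-scal p 0ℚ r φ) (drop (pairing p φ) (pairing r φ))
  where
  drop : ∀ a b → a + - (0ℚ * b) ≡ a
  drop = solve 2 (λ a b → a :- con 0ℚ :* b := a) refl

headFactor : Letter → Word → Ht
headFactor a u = σL a ⊖ scal (δ u) (ρ a)

headFactor-letters : ∀ a u → AllWords IsLetter (headFactor a u)
headFactor-letters a u = AllWords-⊖-scal (δ u) (σL-letters a) (ρ-letters a)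

-- For u ≠ 1 this is the definition of S_t; for u = 1 it says a = σ(a) − ρ(a).
Sw-∷ : ∀ a u → Sw (a ∷ u) ≋ headFactor a u ⊛ Sw u
Sw-∷ x [] = pairing-≡ λ φ → unit (φ 0 (x ∷ []))
  where
  unit : ∀ a → 1ℚ * a + 0ℚ ≡ 1ℚ * 1ℚ * a + 0ℚ
  unit = solve 1 (λ a → con 1ℚ :* a :+ con 0ℚ := con 1ℚ :* con 1ℚ :* a :+ con 0ℚ) refl
Sw-∷ y [] = pairing-≡ λ φ → cancel (φ 1 (x ∷ [])) (φ 0 (y ∷ []))
  where
  cancel : ∀ a b → 1ℚ * b + 0ℚ ≡ 1ℚ * 1ℚ * a + (1ℚ * 1ℚ * b + (- (1ℚ * 1ℚ) * 1ℚ * a + 0ℚ))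
  cancel = solve 2 (λ a b → con 1ℚ :* b :+ con 0ℚ
                      := con 1ℚ :* con 1ℚ :* a
                         :+ (con 1ℚ :* con 1ℚ :* b :+ (:- (con 1ℚ :* con 1ℚ) :* con 1ℚ :* a :+ con 0ℚ))) refl
Sw-∷ a (c ∷ u) = ≋-sym (≋-trans (⊛-distribʳ-⊖-scal (σL a) 0ℚ (ρ a) (Sw (c ∷ u)))
                                 (⊖-scal-zero (σL a ⊛ Sw (c ∷ u)) (ρ a ⊛ Sw (c ∷ u))))

scal-δ-⧢ˡ : ∀ u M Z → scal (δ u) (M ⊛ (Sw u ⧢ Z)) ≋ scal (δ u) (M ⊛ Z)
scal-δ-⧢ˡ [] M Z = scal-cong 1ℚ (⊛-cong (≋-refl {M}) (one-⧢ Z))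
scal-δ-⧢ˡ (c ∷ u) M Z = ≋-trans (scal-zero _) (≋-sym (scal-zero _))

scal-δ-⧢ʳ : ∀ v M Z → scal (δ v) (M ⊛ (Z ⧢ Sw v)) ≋ scal (δ v) (M ⊛ Z)
scal-δ-⧢ʳ [] M Z = scal-cong 1ℚ (⊛-cong (≋-refl {M}) (⧢-one Z))
scal-δ-⧢ʳ (c ∷ v) M Z = ≋-trans (scal-zero _) (≋-sym (scal-zero _))

S-tshw-∷ : ∀ a u b v →
  S (tshw (a ∷ u) (b ∷ v)) ≋
    (((σL a ⊛ S (tshw u (b ∷ v))) ⊕ (σL b ⊛ S (tshw (a ∷ u) v)))
      ⊖ scal (δ u) (ρ a ⊛ Sw (b ∷ v))) ⊖ scal (δ v) (ρ b ⊛ Sw (a ∷ u))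
S-tshw-∷ a u b v = begin
  S (((A ⊕ B) ⊖ scal (δ u) C) ⊖ scal (δ v) D)
    ≈⟨ lin-⊖-scal Sw ((A ⊕ B) ⊖ scal (δ u) C) (δ v) D ⟩
  S ((A ⊕ B) ⊖ scal (δ u) C) ⊖ scal (δ v) (S D)
    ≈⟨ ⊖-cong (lin-⊖-scal Sw (A ⊕ B) (δ u) C) (≋-refl {scal (δ v) (S D)}) ⟩
  (S (A ⊕ B) ⊖ scal (δ u) (S C)) ⊖ scal (δ v) (S D)
    ≈⟨ ⊖-cong (⊖-cong (lin-⊕ Sw A B) (≋-refl {scal (δ u) (S C)})) (≋-refl {scal (δ v) (S D)}) ⟩
  ((S A ⊕ S B) ⊖ scal (δ u) (S C)) ⊖ scal (δ v) (S D)
    ≈⟨ ⊖-cong (⊖-cong (⊕-cong (S-letter-⊛ a (tshw-nonEmptyˡ u b v))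
                              (S-letter-⊛ b (tshw-nonEmptyʳ a u v)))
                      (scal-cong (δ u) (S-ρ-⊛ a (nonEmpty b v ∷ []))))
              (scal-cong (δ v) (S-ρ-⊛ b (nonEmpty a u ∷ []))) ⟩
  (((σL a ⊛ S (tshw u (b ∷ v))) ⊕ (σL b ⊛ S (tshw (a ∷ u) v)))
    ⊖ scal (δ u) (ρ a ⊛ S (word (b ∷ v)))) ⊖ scal (δ v) (ρ b ⊛ S (word (a ∷ u)))
    ≈⟨ ⊖-cong (⊖-cong (≋-refl {(σL a ⊛ S (tshw u (b ∷ v))) ⊕ (σL b ⊛ S (tshw (a ∷ u) v))})
                        (scal-cong (δ u) (⊛-cong (≋-refl {ρ a}) (lin-word Sw (b ∷ v)))))
              (scal-cong (δ v) (⊛-cong (≋-refl {ρ b}) (lin-word Sw (a ∷ u)))) ⟩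
  (((σL a ⊛ S (tshw u (b ∷ v))) ⊕ (σL b ⊛ S (tshw (a ∷ u) v)))
    ⊖ scal (δ u) (ρ a ⊛ Sw (b ∷ v))) ⊖ scal (δ v) (ρ b ⊛ Sw (a ∷ u)) ∎
  where
  open ≋-Reasoning
  A = word (a ∷ []) ⊛ tshw u (b ∷ v)
  B = word (b ∷ []) ⊛ tshw (a ∷ u) v
  C = ρ a ⊛ word (b ∷ v)
  D = ρ b ⊛ word (a ∷ u)

⧢-Sw-∷ : ∀ a u b v →
  Sw (a ∷ u) ⧢ Sw (b ∷ v) ≋
    ((σL a ⊛ (Sw u ⧢ Sw (b ∷ v))) ⊖ scal (δ u) (ρ a ⊛ Sw (b ∷ v)))
      ⊕ ((σL b ⊛ (Sw (a ∷ u) ⧢ Sw v)) ⊖ scal (δ v) (ρ b ⊛ Sw (a ∷ u)))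
⧢-Sw-∷ a u b v = begin
  Sw U ⧢ Sw V
    ≈⟨ bilin-cong shw (Sw-∷ a u) (Sw-∷ b v) ⟩
  (τ ⊛ Sw u) ⧢ (τ′ ⊛ Sw v)
    ≈⟨ ⧢-⊛-letters (Sw u) (Sw v) (headFactor-letters a u) (headFactor-letters b v) ⟩
  (τ ⊛ (Sw u ⧢ (τ′ ⊛ Sw v))) ⊕ (τ′ ⊛ ((τ ⊛ Sw u) ⧢ Sw v))
    ≈⟨ ≋-sym (⊕-cong (⊛-cong (≋-refl {τ}) (bilin-cong shw (≋-refl {Sw u}) (Sw-∷ b v)))
                     (⊛-cong (≋-refl {τ′}) (bilin-cong shw (Sw-∷ a u) (≋-refl {Sw v})))) ⟩
  (τ ⊛ (Sw u ⧢ Sw V)) ⊕ (τ′ ⊛ (Sw U ⧢ Sw v))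
    ≈⟨ ⊕-cong (⊛-distribʳ-⊖-scal (σL a) (δ u) (ρ a) (Sw u ⧢ Sw V))
              (⊛-distribʳ-⊖-scal (σL b) (δ v) (ρ b) (Sw U ⧢ Sw v)) ⟩
  ((σL a ⊛ (Sw u ⧢ Sw V)) ⊖ scal (δ u) (ρ a ⊛ (Sw u ⧢ Sw V)))
    ⊕ ((σL b ⊛ (Sw U ⧢ Sw v)) ⊖ scal (δ v) (ρ b ⊛ (Sw U ⧢ Sw v)))
    ≈⟨ ⊕-cong (⊖-cong (≋-refl {σL a ⊛ (Sw u ⧢ Sw V)}) (scal-δ-⧢ˡ u (ρ a) (Sw V)))
              (⊖-cong (≋-refl {σL b ⊛ (Sw U ⧢ Sw v)}) (scal-δ-⧢ʳ v (ρ b) (Sw U))) ⟩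
  ((σL a ⊛ (Sw u ⧢ Sw V)) ⊖ scal (δ u) (ρ a ⊛ Sw V))
    ⊕ ((σL b ⊛ (Sw U ⧢ Sw v)) ⊖ scal (δ v) (ρ b ⊛ Sw U)) ∎
  where
  open ≋-Reasoning
  U = a ∷ u
  V = b ∷ v
  τ = headFactor a u
  τ′ = headFactor b v

S-tshw : ∀ u v → S (tshw u v) ≋ Sw u ⧢ Sw v
S-tshw [] v = ≋-trans (lin-word Sw v) (≋-sym (one-⧢ (Sw v)))
S-tshw (a ∷ u) [] = ≋-trans (lin-word Sw (a ∷ u)) (≋-sym (⧢-one (Sw (a ∷ u))))
S-tshw (a ∷ u) (b ∷ v) = begin
  S (tshw (a ∷ u) (b ∷ v))
    ≈⟨ S-tshw-∷ a u b v ⟩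
  (((σL a ⊛ S (tshw u (b ∷ v))) ⊕ (σL b ⊛ S (tshw (a ∷ u) v))) ⊖ ρ-termˡ) ⊖ ρ-termʳ
    ≈⟨ ⊖-cong (⊖-cong (⊕-cong (⊛-cong (≋-refl {σL a}) (S-tshw u (b ∷ v)))
                              (⊛-cong (≋-refl {σL b}) (S-tshw (a ∷ u) v)))
                      (≋-refl {ρ-termˡ}))
              (≋-refl {ρ-termʳ}) ⟩
  (((σL a ⊛ (Sw u ⧢ Sw (b ∷ v))) ⊕ (σL b ⊛ (Sw (a ∷ u) ⧢ Sw v))) ⊖ ρ-termˡ) ⊖ ρ-termʳ
    ≈⟨ ≋-sym (⊖-⊕-interchange (σL a ⊛ (Sw u ⧢ Sw (b ∷ v))) (σL b ⊛ (Sw (a ∷ u) ⧢ Sw v)) ρ-termˡ ρ-termʳ) ⟩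
  ((σL a ⊛ (Sw u ⧢ Sw (b ∷ v))) ⊖ ρ-termˡ) ⊕ ((σL b ⊛ (Sw (a ∷ u) ⧢ Sw v)) ⊖ ρ-termʳ)
    ≈⟨ ≋-sym (⧢-Sw-∷ a u b v) ⟩
  Sw (a ∷ u) ⧢ Sw (b ∷ v) ∎
  where
  open ≋-Reasoning
  ρ-termˡ = scal (δ u) (ρ a ⊛ Sw (b ∷ v))
  ρ-termʳ = scal (δ v) (ρ b ⊛ Sw (a ∷ u))

proposition2p1 : ∀ (w₁ w₂ : Ht) → S (w₁ ⧢t w₂) ≈ (S w₁ ⧢ S w₂)
proposition2p1 w₁ w₂ = ≋⇒≈ (begin
  S (w₁ ⧢t w₂)                        ≈⟨ lin-bilin Sw tshw w₁ w₂ ⟩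
  bilin (λ u v → S (tshw u v)) w₁ w₂   ≈⟨ bilin-congᶠ S-tshw w₁ w₂ ⟩
  bilin (λ u v → Sw u ⧢ Sw v) w₁ w₂    ≈⟨ ≋-sym (bilin-lin shw Sw Sw w₁ w₂) ⟩
  S w₁ ⧢ S w₂                          ∎)
  where open ≋-Reasoning
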